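{- Let $k\ge 2$ be an integer such that $n=2k+1$ is prime. Then there is a connected $k$-colouring of $K_n$ in which exactly $\frac{k(k-2)}{3}$ distinct $3$-subsets of colours occur as colour sets of multicoloured triangles.
   Context: An edge-colouring of the complete graph $K_n$ with colours from $[k]=\{1,\dots,k\}$ is a connected $k$-colouring if, for every colour $i\in[k]$, the edges of colour $i$ are non-empty and form a connected spanning subgraph of $K_n$. A triangle is multicoloured if its three edges receive three distinct colours; its colour set is the set of these three colours. (The paper counts "multicoloured triangles" by their colour sets.) -}

module Defs where

open import Data.Nat using (ℕ; _<_)
open import Data.Fin using (Fin; toℕ)
open import Data.Product using (Σ; ∃; ∃-syntax; _×_)
open import Data.Sum using (_⊎_)
open import Data.List using (List; length)
open import Data.List.Membership.Propositional using (_∈_)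
open import Data.List.Relation.Unary.Unique.Propositional using (Unique)
open import Relation.Binary.PropositionalEquality using (_≡_; _≢_)
open import Function.Bundles using (_⇔_)

-- An edge-colouring of K_n with colours Fin k: a symmetric function on
-- pairs of vertices (values on the diagonal u = u are irrelevant).
record Colouring (n k : ℕ) : Set where
  field
    col : Fin n → Fin n → Fin k
    sym : ∀ u v → col u v ≡ col v u
open Colouring public

data Walk {n k : ℕ} (c : Colouring n k) (i : Fin k) : Fin n → Fin n → Set where
  here : ∀ {u} → Walk c i u u
  step : ∀ {u w v} → u ≢ w → col c u w ≡ i → Walk c i w v → Walk c i u v

ColourConnected : {n k : ℕ} → Colouring n k → Fin k → Set
ColourConnected {n} c i =
  (∃[ u ] ∃[ v ] (u ≢ v × col c u v ≡ i)) × (∀ u v → Walk c i u v)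

IsConnectedColouring : {n k : ℕ} → Colouring n k → Set
IsConnectedColouring {k = k} c = ∀ (i : Fin k) → ColourConnected c i

-- 3-subsets of colours, represented as strictly increasing triples
record Triple (k : ℕ) : Set where
  constructor triple
  field
    a b d : Fin k
    a<b : toℕ a < toℕ b
    b<d : toℕ b < toℕ d
open Triple

Multicoloured : {n k : ℕ} → Colouring n k → Fin n → Fin n → Fin n → Set
Multicoloured c x y z =
  x ≢ y × y ≢ z × x ≢ z ×
  col c x y ≢ col c y z × col c y z ≢ col c x z × col c x y ≢ col c x z

ColourSetIs : {n k : ℕ} → Colouring n k → Fin n → Fin n → Fin n → Triple k → Set
ColourSetIs {k = k} c x y z t = ∀ (j : Fin k) →
  (j ≡ col c x y ⊎ j ≡ col c y z ⊎ j ≡ col c x z) ⇔ (j ≡ a t ⊎ j ≡ b t ⊎ j ≡ d t)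

Occurs : {n k : ℕ} → Colouring n k → Triple k → Set
Occurs c t = ∃[ x ] ∃[ y ] ∃[ z ] (Multicoloured c x y z × ColourSetIs c x y z t)

NumOccurringIs : {n k : ℕ} → Colouring n k → ℕ → Set
NumOccurringIs {k = k} c m = Σ (List (Triple k)) λ ts →
  Unique ts × length ts ≡ m × (∀ t → (t ∈ ts) ⇔ Occurs c t)

-- Colour the edge uv of K_P, P = 2k + 1 prime, by the length d = min(|u - v|, P - |u - v|)
-- of uv as a chord of the P-cycle.  Colour class d is the circulant graph x ~ x ± d, which
-- is connected because d is invertible modulo P.  The three chord lengths of a triangle
-- satisfy ±A ± B ± D ≡ 0 (mod P), so for A < B < D the colour set {A, B, D} occurs exactly
-- when D = A + B or A + B + D = P, the triangle 0, A, A + B realising it.  Such sets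
-- correspond to the pairs A < B with A + 2B < P (then D = min(A + B, P - A - B)), i.e. to
-- the lattice points a < b, a + 2b < 2(k - 1), of which there are ((k - 1)² - 1)/3 when
-- 3 ∤ k - 1; primality of P rules out 3 ∣ k - 1.
module Submission where

open import Defs
open import Data.Nat using (ℕ; _≤_; _+_; _*_; _∸_; _/_)
open import Data.Nat.Primality using (Prime)
open import Data.Product using (Σ; _×_)

open import Data.Empty using (⊥-elim)
open import Data.Fin using (Fin; toℕ; fromℕ<)
import Data.Fin.Properties as Fin
open import Data.Fin.Properties
  using (toℕ-injective; toℕ<n; toℕ-fromℕ<; fromℕ<-cong; fromℕ<-toℕ)
open import Data.List using (List; []; _∷_; _++_; map; length; applyUpTo)
open import Data.List.Membership.Propositional using (_∈_; mapWith∈)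
open import Data.List.Membership.Propositional.Properties
  using (∈-++⁺ˡ; ∈-++⁺ʳ; ∈-++⁻; ∈-map⁺; ∈-map⁻; ∈-applyUpTo⁺; ∈-applyUpTo⁻)
open import Data.List.Properties using (length-++; length-map; length-applyUpTo)
open import Data.List.Relation.Binary.Disjoint.Propositional using (Disjoint)
import Data.List.Relation.Unary.All as All
open import Data.List.Relation.Unary.AllPairs using ([]; _∷_)
open import Data.List.Relation.Unary.Any using (here; there)
import Data.List.Relation.Unary.Any.Properties as Any
open import Data.List.Relation.Unary.Unique.Propositional using (Unique)
import Data.List.Relation.Unary.Unique.Propositional.Properties as UniqueProps
open import Data.Nat
  using (NonZero; >-nonZero; zero; suc; pred; z≤n; s≤s; z<s; s<s; s<s⁻¹; _<_; _<?_; _≤?_;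
         _⊓_; ∣_-_∣; ⌊_/2⌋; ⌈_/2⌉)
open import Data.Nat.Coprimality using (coprime-Bézout; prime⇒coprime)
open import Data.Nat.Divisibility using (_∣_; _∤_; _∣0; ∣-refl; ∣m∣n⇒∣m+n; ∣n⇒∣m*n)
open import Data.Nat.DivMod
  using (_%_; m%n<n; m<n⇒m%n≡m; m%n%n≡m%n; [m+n]%n≡m%n; [m+kn]%n≡m%n; %-distribˡ-+;
         m*n/n≡m)
open import Data.Nat.GCD using (module Bézout)
open import Data.Nat.Primality using (prime⇒irreducible)
open import Data.Nat.Properties
open import Algebra.Properties.CommutativeSemigroup +-commutativeSemigroup
  using (xy∙z≈xz∙y; x∙yz≈zx∙y; x∙yz≈yx∙z; x∙yz≈y∙xz)
open import Data.Nat.Tactic.RingSolver using (solve-∀)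
open import Data.Product as Product using (∃-syntax; _,_; proj₁; proj₂)
open import Data.Sum using (_⊎_; inj₁; inj₂; [_,_]′)
open import Function.Base using (_∘_)
open import Function.Bundles using (_⇔_; mk⇔; Equivalence)
open import Function.Properties.Equivalence using () renaming (trans to ⇔-trans; sym to ⇔-sym)
open import Relation.Binary.Definitions using (tri<; tri≈; tri>)
open import Relation.Binary.PropositionalEquality
  using (_≡_; _≢_; refl; trans; cong; cong₂; subst; subst₂; module ≡-Reasoning)
  renaming (sym to ≡-sym)
open import Relation.Nullary using (yes; no)


OneOf : {A : Set} → A → A → A → A → Set
OneOf x p q r = x ≡ p ⊎ x ≡ q ⊎ x ≡ r

module Symmetric₃ {A : Set} (R : A → A → A → Set)
  (swap₁₂ : ∀ {p q r} → R p q r → R q p r)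
  (swap₂₃ : ∀ {p q r} → R p q r → R p r q) where

  swap₁₃ : ∀ {p q r} → R p q r → R r q p
  swap₁₃ = swap₁₂ ∘ swap₂₃ ∘ swap₁₂

  private
    oneOf₁ : ∀ {x p q r : A} → OneOf x p q r → x ≢ q → x ≢ r → x ≡ p
    oneOf₁ (inj₁ x≡p)        _   _   = x≡p
    oneOf₁ (inj₂ (inj₁ x≡q)) x≢q _   = ⊥-elim (x≢q x≡q)
    oneOf₁ (inj₂ (inj₂ x≡r)) _   x≢r = ⊥-elim (x≢r x≡r)

    oneOf₂ : ∀ {x p q r : A} → OneOf x p q r → x ≢ p → x ≢ r → x ≡ q
    oneOf₂ (inj₁ x≡p)        x≢p _   = ⊥-elim (x≢p x≡p)
    oneOf₂ (inj₂ (inj₁ x≡q)) _   _   = x≡q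
    oneOf₂ (inj₂ (inj₂ x≡r)) _   x≢r = ⊥-elim (x≢r x≡r)

    oneOf₃ : ∀ {x p q r : A} → OneOf x p q r → x ≢ p → x ≢ q → x ≡ r
    oneOf₃ (inj₁ x≡p)        x≢p _   = ⊥-elim (x≢p x≡p)
    oneOf₃ (inj₂ (inj₁ x≡q)) _   x≢q = ⊥-elim (x≢q x≡q)
    oneOf₃ (inj₂ (inj₂ x≡r)) _   _   = x≡r

  permute : ∀ {p q r a b d} → R p q r → a ≢ b → b ≢ d → a ≢ d →
            OneOf a p q r → OneOf b p q r → OneOf d p q r → R a b d
  permute rpqr a≢b b≢d _ (inj₁ refl) b∈ (inj₂ (inj₁ refl))
    rewrite oneOf₃ b∈ (a≢b ∘ ≡-sym) b≢d = swap₂₃ rpqr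
  permute rpqr a≢b b≢d _ (inj₁ refl) b∈ (inj₂ (inj₂ refl))
    rewrite oneOf₂ b∈ (a≢b ∘ ≡-sym) b≢d = rpqr
  permute rpqr a≢b b≢d _ (inj₂ (inj₁ refl)) b∈ (inj₁ refl)
    rewrite oneOf₃ b∈ b≢d (a≢b ∘ ≡-sym) = swap₂₃ (swap₁₂ rpqr)
  permute rpqr a≢b b≢d _ (inj₂ (inj₁ refl)) b∈ (inj₂ (inj₂ refl))
    rewrite oneOf₁ b∈ (a≢b ∘ ≡-sym) b≢d = swap₁₂ rpqr
  permute rpqr a≢b b≢d _ (inj₂ (inj₂ refl)) b∈ (inj₁ refl)
    rewrite oneOf₂ b∈ b≢d (a≢b ∘ ≡-sym) = swap₁₃ rpqr
  permute rpqr a≢b b≢d _ (inj₂ (inj₂ refl)) b∈ (inj₂ (inj₁ refl))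
    rewrite oneOf₁ b∈ b≢d (a≢b ∘ ≡-sym) = swap₁₂ (swap₂₃ rpqr)
  permute _ _ _ a≢d (inj₁ refl)        _ (inj₁ refl)        = ⊥-elim (a≢d refl)
  permute _ _ _ a≢d (inj₂ (inj₁ refl)) _ (inj₂ (inj₁ refl)) = ⊥-elim (a≢d refl)
  permute _ _ _ a≢d (inj₂ (inj₂ refl)) _ (inj₂ (inj₂ refl)) = ⊥-elim (a≢d refl)

module _ (Q : ℕ → ℕ → ℕ → Set)
  (swap₁₂ : ∀ {x y z} → Q x y z → Q y x z)
  (swap₂₃ : ∀ {x y z} → Q x y z → Q x z y) where
  open Symmetric₃ Q swap₁₂ swap₂₃ using (swap₁₃)

  wlog-increasing : (∀ {x y z} → x < y → y < z → Q x y z) →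
                    ∀ {x y z} → x ≢ y → y ≢ z → x ≢ z → Q x y z
  wlog-increasing Q↑ {x} {y} {z} x≢y y≢z x≢z with <-cmp x y | <-cmp y z | <-cmp x z
  ... | tri≈ _ x≡y _ | _            | _            = ⊥-elim (x≢y x≡y)
  ... | _            | tri≈ _ y≡z _ | _            = ⊥-elim (y≢z y≡z)
  ... | _            | _            | tri≈ _ x≡z _ = ⊥-elim (x≢z x≡z)
  ... | tri< x<y _ _ | tri< y<z _ _ | _            = Q↑ x<y y<z
  ... | tri< _ _ _   | tri> _ _ z<y | tri< x<z _ _ = swap₂₃ (Q↑ x<z z<y)
  ... | tri< x<y _ _ | tri> _ _ _   | tri> _ _ z<x = swap₂₃ (swap₁₂ (Q↑ z<x x<y))
  ... | tri> _ _ y<x | tri< _ _ _   | tri< x<z _ _ = swap₁₂ (Q↑ y<x x<z)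
  ... | tri> _ _ _   | tri< y<z _ _ | tri> _ _ z<x = swap₁₂ (swap₂₃ (Q↑ y<z z<x))
  ... | tri> _ _ y<x | tri> _ _ z<y | _            = swap₁₃ (Q↑ z<y y<x)

module _ {A B : Set} where

  length-mapWith∈ : (xs : List A) (f : ∀ {x} → x ∈ xs → B) →
                    length (mapWith∈ xs f) ≡ length xs
  length-mapWith∈ []       f = refl
  length-mapWith∈ (x ∷ xs) f = cong suc (length-mapWith∈ xs (f ∘ there))

  mapWith∈-unique : (xs : List A) (f : ∀ {x} → x ∈ xs → B) →
                    (∀ {x y} (x∈ : x ∈ xs) (y∈ : y ∈ xs) → f x∈ ≡ f y∈ → x ≡ y) →
                    Unique xs → Unique (mapWith∈ xs f)
  mapWith∈-unique []       f f-inj []             = []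
  mapWith∈-unique (x ∷ xs) f f-inj (x∉xs ∷ !xs) =
    All.tabulate fresh ∷
    mapWith∈-unique xs (f ∘ there) (λ x∈ y∈ → f-inj (there x∈) (there y∈)) !xs
    where
    fresh : ∀ {v} → v ∈ mapWith∈ xs (f ∘ there) → f (here refl) ≢ v
    fresh v∈ fx≡v with Any.mapWith∈⁻ xs (f ∘ there) v∈
    ... | y , y∈ , refl = All.lookup x∉xs y∈ (f-inj (here refl) (there y∈) fx≡v)

record ColouredTriangle {n k : ℕ} (c : Colouring n k) (p q r : Fin k) : Set where
  field
    x y z  : Fin n
    x≢y    : x ≢ y
    y≢z    : y ≢ z
    x≢z    : x ≢ z
    col-xy : col c x y ≡ p
    col-yz : col c y z ≡ q
    col-xz : col c x z ≡ r

module _ {n k : ℕ} (c : Colouring n k) where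
  open ColouredTriangle

  triangle-swap₁₂ : ∀ {p q r} → ColouredTriangle c p q r → ColouredTriangle c q p r
  triangle-swap₁₂ T = record
    { x = z T ; y = y T ; z = x T
    ; x≢y = y≢z T ∘ ≡-sym ; y≢z = x≢y T ∘ ≡-sym ; x≢z = x≢z T ∘ ≡-sym
    ; col-xy = trans (sym c (z T) (y T)) (col-yz T)
    ; col-yz = trans (sym c (y T) (x T)) (col-xy T)
    ; col-xz = trans (sym c (z T) (x T)) (col-xz T)
    }

  triangle-swap₂₃ : ∀ {p q r} → ColouredTriangle c p q r → ColouredTriangle c p r q
  triangle-swap₂₃ T = record
    { x = y T ; y = x T ; z = z T
    ; x≢y = x≢y T ∘ ≡-sym ; y≢z = x≢z T ; x≢z = y≢z T
    ; col-xy = trans (sym c (y T) (x T)) (col-xy T)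
    ; col-yz = col-xz T
    ; col-xz = col-yz T
    }

  open Symmetric₃ (ColouredTriangle c) triangle-swap₁₂ triangle-swap₂₃ using (permute)

  occurs⇔triangle : (t : Triple k) →
                    Occurs c t ⇔ ColouredTriangle c (Triple.a t) (Triple.b t) (Triple.d t)
  occurs⇔triangle (triple a b d a<b b<d) = mk⇔ to from
    where
    a≢b = Fin.<⇒≢ a<b
    b≢d = Fin.<⇒≢ b<d
    a≢d = Fin.<⇒≢ (<-trans a<b b<d)

    to : Occurs c (triple a b d a<b b<d) → ColouredTriangle c a b d
    to (x , y , z , (x≢y , y≢z , x≢z , _) , colours) =
      permute (record { x = x ; y = y ; z = z ; x≢y = x≢y ; y≢z = y≢z ; x≢z = x≢z
                      ; col-xy = refl ; col-yz = refl ; col-xz = refl })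
              a≢b b≢d a≢d
              (∈colours a (inj₁ refl)) (∈colours b (inj₂ (inj₁ refl))) (∈colours d (inj₂ (inj₂ refl)))
      where ∈colours = λ j → Equivalence.from (colours j)

    sameSet : ∀ {p q r p′ q′ r′ : Fin k} → p ≡ p′ → q ≡ q′ → r ≡ r′ →
              ∀ j → OneOf j p q r ⇔ OneOf j p′ q′ r′
    sameSet refl refl refl j = mk⇔ (λ j∈ → j∈) (λ j∈ → j∈)

    from : ColouredTriangle c a b d → Occurs c (triple a b d a<b b<d)
    from T = x T , y T , z T
           , (x≢y T , y≢z T , x≢z T
             , distinct a≢b (col-xy T) (col-yz T)
             , distinct b≢d (col-yz T) (col-xz T)
             , distinct a≢d (col-xy T) (col-xz T))
           , sameSet (col-xy T) (col-yz T) (col-xz T)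
      where
      distinct : ∀ {i j p q : Fin k} → i ≢ j → p ≡ i → q ≡ j → p ≢ q
      distinct i≢j refl refl = i≢j

-- Lattice points (a, b) with a < b and a + 2b < n

2*t<n⇒t<⌈n/2⌉ : ∀ {t n} → 2 * t < n → t < ⌈ n /2⌉
2*t<n⇒t<⌈n/2⌉ {zero}  {suc n}       _        = z<s
2*t<n⇒t<⌈n/2⌉ {suc t} {suc zero}    (s≤s ())
2*t<n⇒t<⌈n/2⌉ {suc t} {suc (suc n)} 2t<2+n =
  s<s (2*t<n⇒t<⌈n/2⌉ (s<s⁻¹ (s<s⁻¹ (subst (_< 2 + n) (*-suc 2 t) 2t<2+n))))

t<⌈n/2⌉⇒2*t<n : ∀ {t n} → t < ⌈ n /2⌉ → 2 * t < n
t<⌈n/2⌉⇒2*t<n {zero}  {suc n}       _ = z<s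
t<⌈n/2⌉⇒2*t<n {suc t} {suc (suc n)} t<⌈n/2⌉ =
  subst (_< 2 + n) (≡-sym (*-suc 2 t)) (s<s (s<s (t<⌈n/2⌉⇒2*t<n (s<s⁻¹ t<⌈n/2⌉))))
t<⌈n/2⌉⇒2*t<n {suc t} {suc zero} (s≤s ())

LatticePoint : ℕ → ℕ × ℕ → Set
LatticePoint n (a , b) = a < b × a + 2 * b < n

latticePoint-irrelevant : ∀ {n p} (h h′ : LatticePoint n p) → h ≡ h′
latticePoint-irrelevant (a<b , w<n) (a<b′ , w<n′) =
  cong₂ _,_ (<-irrelevant a<b a<b′) (<-irrelevant w<n w<n′)

columnPoint : ℕ → ℕ × ℕ
columnPoint t = 0 , suc t

shift : ℕ × ℕ → ℕ × ℕ
shift = Product.map suc suc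

-- shift raises a + 2b by 3, so only the column a = 0 is new
latticePoints : ℕ → List (ℕ × ℕ)
latticePoints (suc (suc (suc n))) =
  applyUpTo columnPoint ⌈ suc n /2⌉ ++ map shift (latticePoints n)
latticePoints _ = []

shift-weight : ∀ a b → suc a + 2 * suc b ≡ 3 + (a + 2 * b)
shift-weight = solve-∀

private
  2≤weight : ∀ a b → 2 ≤ a + 2 * suc b
  2≤weight a b = ≤-trans (m≤m+n 2 (2 * b)) (≤-trans (≤-reflexive (≡-sym (*-suc 2 b))) (m≤n+m _ a))

∈-latticePoints⁻ : ∀ n {p} → p ∈ latticePoints n → LatticePoint n p
∈-latticePoints⁻ (suc (suc (suc n))) p∈ with ∈-++⁻ (applyUpTo columnPoint ⌈ suc n /2⌉) p∈
... | inj₁ p∈column with ∈-applyUpTo⁻ columnPoint p∈column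
...   | t , t<⌈n/2⌉ , refl =
        z<s , subst (_< 3 + n) (≡-sym (*-suc 2 t)) (s<s (s<s (t<⌈n/2⌉⇒2*t<n t<⌈n/2⌉)))
∈-latticePoints⁻ (suc (suc (suc n))) p∈ | inj₂ p∈shifted with ∈-map⁻ shift p∈shifted
... | (a , b) , ab∈ , refl with ∈-latticePoints⁻ n ab∈
...   | a<b , a+2b<n =
        s<s a<b , subst (_< 3 + n) (≡-sym (shift-weight a b)) (+-monoʳ-< 3 a+2b<n)

∈-latticePoints⁺ : ∀ n {p} → LatticePoint n p → p ∈ latticePoints n
∈-latticePoints⁺ (suc (suc (suc n))) {zero , suc b} (_ , weight<) =
  ∈-++⁺ˡ (∈-applyUpTo⁺ columnPoint
    (2*t<n⇒t<⌈n/2⌉ (s<s⁻¹ (s<s⁻¹ (subst (_< 3 + n) (*-suc 2 b) weight<)))))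
∈-latticePoints⁺ (suc (suc (suc n))) {suc a , suc b} (s<s a<b , weight<) =
  ∈-++⁺ʳ _ (∈-map⁺ shift
    (∈-latticePoints⁺ n (a<b , +-cancelˡ-< 3 _ _ (subst (_< 3 + n) (shift-weight a b) weight<))))
∈-latticePoints⁺ zero             {a , b}     (_ , ())
∈-latticePoints⁺ (suc zero)       {a , suc b} (_ , weight<) =
  ⊥-elim (<⇒≱ weight< (≤-trans (s≤s z≤n) (2≤weight a b)))
∈-latticePoints⁺ (suc (suc zero)) {a , suc b} (_ , weight<) =
  ⊥-elim (<⇒≱ weight< (2≤weight a b))

latticePoints-unique : ∀ n → Unique (latticePoints n)
latticePoints-unique (suc (suc (suc n))) =
  UniqueProps.++⁺
    (UniqueProps.applyUpTo⁺₁ columnPoint ⌈ suc n /2⌉ (λ i<j _ → <⇒≢ i<j ∘ suc-injective ∘ cong proj₂))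
    (UniqueProps.map⁺ shift-injective (latticePoints-unique n))
    column-disjoint
  where
  shift-injective : ∀ {p q} → shift p ≡ shift q → p ≡ q
  shift-injective refl = refl

  column-disjoint : Disjoint (applyUpTo columnPoint ⌈ suc n /2⌉) (map shift (latticePoints n))
  column-disjoint (v∈column , v∈shifted)
    with ∈-applyUpTo⁻ columnPoint v∈column | ∈-map⁻ shift v∈shifted
  ... | _ , _ , refl | _ , _ , ()
latticePoints-unique zero             = []
latticePoints-unique (suc zero)       = []
latticePoints-unique (suc (suc zero)) = []

length-latticePoints-3+ : ∀ n →
  length (latticePoints (3 + n)) ≡ ⌈ suc n /2⌉ + length (latticePoints n)
length-latticePoints-3+ n = begin
  length (applyUpTo columnPoint ⌈ suc n /2⌉ ++ map shift (latticePoints n))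
    ≡⟨ length-++ (applyUpTo columnPoint ⌈ suc n /2⌉) ⟩
  length (applyUpTo columnPoint ⌈ suc n /2⌉) + length (map shift (latticePoints n))
    ≡⟨ cong₂ _+_ (length-applyUpTo columnPoint ⌈ suc n /2⌉) (length-map shift (latticePoints n)) ⟩
  ⌈ suc n /2⌉ + length (latticePoints n) ∎
  where open ≡-Reasoning

length-latticePoints-6+ : ∀ n → length (latticePoints (6 + n)) ≡ 3 + n + length (latticePoints n)
length-latticePoints-6+ n = begin
  length (latticePoints (6 + n))
    ≡⟨ length-latticePoints-3+ (3 + n) ⟩
  ⌈ 4 + n /2⌉ + length (latticePoints (3 + n))
    ≡⟨ cong (⌈ 4 + n /2⌉ +_) (length-latticePoints-3+ n) ⟩
  2 + ⌈ n /2⌉ + (1 + ⌊ n /2⌋ + length (latticePoints n))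
    ≡⟨ regroup ⌊ n /2⌋ ⌈ n /2⌉ (length (latticePoints n)) ⟩
  3 + (⌊ n /2⌋ + ⌈ n /2⌉) + length (latticePoints n)
    ≡⟨ cong (λ s → 3 + s + length (latticePoints n)) (⌊n/2⌋+⌈n/2⌉≡n n) ⟩
  3 + n + length (latticePoints n) ∎
  where
  open ≡-Reasoning
  regroup : ∀ x y l → 2 + y + (1 + x + l) ≡ 3 + (x + y) + l
  regroup = solve-∀

latticePoints-count : ∀ m → 3 ∤ m → 3 * length (latticePoints (2 * m)) + 1 ≡ m * m
latticePoints-count zero             3∤0 = ⊥-elim (3∤0 (3 ∣0))
latticePoints-count (suc zero)       _   = refl
latticePoints-count (suc (suc zero)) _   = refl
latticePoints-count (suc (suc (suc m))) 3∤3+m = begin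
  3 * L (2 * (3 + m)) + 1         ≡⟨ cong (λ n → 3 * L n + 1) (double m) ⟩
  3 * L (6 + 2 * m) + 1           ≡⟨ cong (λ l → 3 * l + 1) (length-latticePoints-6+ (2 * m)) ⟩
  3 * (3 + 2 * m + L (2 * m)) + 1 ≡⟨ expand m (L (2 * m)) ⟩
  9 + 6 * m + (3 * L (2 * m) + 1) ≡⟨ cong (9 + 6 * m +_) (latticePoints-count m 3∤m) ⟩
  9 + 6 * m + m * m               ≡⟨ square m ⟩
  (3 + m) * (3 + m)               ∎
  where
  open ≡-Reasoning
  L : ℕ → ℕ
  L n = length (latticePoints n)
  3∤m : 3 ∤ m
  3∤m = 3∤3+m ∘ ∣m∣n⇒∣m+n ∣-refl
  double : ∀ m → 2 * (3 + m) ≡ 6 + 2 * m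
  double = solve-∀
  expand : ∀ m l → 3 * (3 + 2 * m + l) + 1 ≡ 9 + 6 * m + (3 * l + 1)
  expand = solve-∀
  square : ∀ m → 9 + 6 * m + m * m ≡ (3 + m) * (3 + m)
  square = solve-∀

%-cong-+ : ∀ N .{{_ : NonZero N}} a a′ b b′ →
           a % N ≡ a′ % N → b % N ≡ b′ % N → (a + b) % N ≡ (a′ + b′) % N
%-cong-+ N a a′ b b′ a≡a′ b≡b′ = begin
  (a + b) % N           ≡⟨ %-distribˡ-+ a b N ⟩
  (a % N + b % N) % N   ≡⟨ cong₂ (λ v w → (v + w) % N) a≡a′ b≡b′ ⟩
  (a′ % N + b′ % N) % N ≡⟨ %-distribˡ-+ a′ b′ N ⟨
  (a′ + b′) % N         ∎
  where open ≡-Reasoning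

bézout⇒multiples : ∀ {N c} .{{_ : NonZero N}} → Bézout.Identity 1 N c →
                   ∀ r → ∃[ s ] (s * c) % N ≡ r % N
bézout⇒multiples {N} {c} (Bézout.-+ x y 1+xN≡yc) r = r * y , (begin
  (r * y * c) % N       ≡⟨ cong (_% N) (trans (*-assoc r y c) (cong (r *_) (≡-sym 1+xN≡yc))) ⟩
  (r * (1 + x * N)) % N ≡⟨ cong (_% N) (expand r x N) ⟩
  (r + r * x * N) % N   ≡⟨ [m+kn]%n≡m%n r (r * x) N ⟩
  r % N                 ∎)
  where
  open ≡-Reasoning
  expand : ∀ r x N → r * (1 + x * N) ≡ r + r * x * N
  expand = solve-∀
-- here y c ≡ -1 (mod N), so (N - 1) y is an inverse of c
bézout⇒multiples {N} {c} (Bézout.+- x y 1+yc≡xN) r = r * pred N * y , (begin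
  (r * pred N * y * c) % N                    ≡⟨ [m+kn]%n≡m%n _ r N ⟨
  (r * pred N * y * c + r * N) % N            ≡⟨ cong (λ w → (s * c + r * w) % N) (suc-pred N) ⟨
  (r * pred N * y * c + r * suc (pred N)) % N ≡⟨ cong (_% N) (regroup r (pred N) y c) ⟩
  (r + r * pred N * (1 + y * c)) % N          ≡⟨ cong (λ w → (r + r * pred N * w) % N) 1+yc≡xN ⟩
  (r + r * pred N * (x * N)) % N              ≡⟨ cong (λ w → (r + w) % N) (*-assoc (r * pred N) x N) ⟨
  (r + r * pred N * x * N) % N                ≡⟨ [m+kn]%n≡m%n r (r * pred N * x) N ⟩
  r % N                                       ∎)
  where
  open ≡-Reasoning
  s = r * pred N * y
  regroup : ∀ r n y c → r * n * y * c + r * suc n ≡ r + r * n * (1 + y * c)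
  regroup = solve-∀

prime⇒3∤ : ∀ {m} → 1 ≤ m → Prime (2 * suc m + 1) → 3 ∤ m
prime⇒3∤ {m} 1≤m P-prime 3∣m = [ (λ ()) , 3≢P ]′ (prime⇒irreducible P-prime 3∣P)
  where
  P≡2m+3 : 2 * suc m + 1 ≡ 2 * m + 3
  P≡2m+3 = rearrange m
    where
    rearrange : ∀ m → 2 * suc m + 1 ≡ 2 * m + 3
    rearrange = solve-∀

  3∣P : 3 ∣ 2 * suc m + 1
  3∣P = subst (3 ∣_) (≡-sym P≡2m+3) (∣m∣n⇒∣m+n (∣n⇒∣m*n 2 3∣m) ∣-refl)

  3≢P : 3 ≢ 2 * suc m + 1
  3≢P = <⇒≢ (subst (3 <_) (≡-sym P≡2m+3) (m<n+m 3 (≤-trans 1≤m (m≤m+n m (m + 0)))))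

-- Chord lengths in the cycle of length P = 2k + 1

module CircularDistance (k : ℕ) where

  P : ℕ
  P = 2 * k + 1

  arc : ℕ → ℕ
  arc d = d ⊓ (P ∸ d)

  dist : ℕ → ℕ → ℕ
  dist x y = arc ∣ x - y ∣

  dist-comm : ∀ x y → dist x y ≡ dist y x
  dist-comm x y = cong arc (∣-∣-comm x y)

  private
    P≡1+k+k : P ≡ suc (k + k)
    P≡1+k+k = rearrange k
      where
      rearrange : ∀ k → 2 * k + 1 ≡ suc (k + k)
      rearrange = solve-∀

    P∸k≡1+k : P ∸ k ≡ suc k
    P∸k≡1+k = trans (cong (_∸ k) P≡1+k+k) (m+n∸n≡m (suc k) k)

    k+k<P : k + k < P
    k+k<P = ≤-reflexive (≡-sym P≡1+k+k)

    P∸[1+k]≡k : P ∸ suc k ≡ k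
    P∸[1+k]≡k = trans (cong (_∸ suc k) P≡1+k+k) (m+n∸n≡m k k)

  k<P : k < P
  k<P = ≤-<-trans (m≤m+n k k) k+k<P

  arc-low : ∀ {d} → d ≤ k → arc d ≡ d
  arc-low {d} d≤k = m≤n⇒m⊓n≡m (≤-trans d≤k (≤-trans (n≤1+n k)
    (≤-trans (≤-reflexive (≡-sym P∸k≡1+k)) (∸-monoʳ-≤ P d≤k))))

  arc-high : ∀ {d} → k < d → d ≤ P → arc d + d ≡ P
  arc-high {d} k<d d≤P = trans (cong (_+ d) (m≥n⇒m⊓n≡n P∸d≤d)) (m∸n+n≡m d≤P)
    where
    P∸d≤d : P ∸ d ≤ d
    P∸d≤d = ≤-trans (∸-monoʳ-≤ P k<d) (≤-trans (≤-reflexive P∸[1+k]≡k) (<⇒≤ k<d))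

  data ArcView (d : ℕ) : Set where
    short : d ≤ k → arc d ≡ d → ArcView d
    long  : k < d → arc d + d ≡ P → ArcView d

  arc-view : ∀ d → d ≤ P → ArcView d
  arc-view d d≤P with d ≤? k
  ... | yes d≤k = short d≤k (arc-low d≤k)
  ... | no  d≰k = long (≰⇒> d≰k) (arc-high (≰⇒> d≰k) d≤P)

  arc≤k : ∀ d → arc d ≤ k
  arc≤k d with d ≤? k
  ... | yes d≤k = ≤-trans (m⊓n≤m d (P ∸ d)) d≤k
  ... | no  d≰k =
    ≤-trans (m⊓n≤n d (P ∸ d)) (≤-trans (∸-monoʳ-≤ P (≰⇒> d≰k)) (≤-reflexive P∸[1+k]≡k))

  arc[P∸d]≡arc[d] : ∀ {d} → d ≤ P → arc (P ∸ d) ≡ arc d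
  arc[P∸d]≡arc[d] {d} d≤P = trans (cong ((P ∸ d) ⊓_) (m∸[m∸n]≡n d≤P)) (⊓-comm (P ∸ d) d)

  arc-positive : ∀ {d} → 0 < d → d < P → 0 < arc d
  arc-positive {d} 0<d d<P with arc-view d (<⇒≤ d<P)
  ... | short _ arc[d]≡d  = subst (0 <_) (≡-sym arc[d]≡d) 0<d
  ... | long  _ arc[d]+d≡P =
    n≢0⇒n>0 λ arc[d]≡0 → <⇒≢ d<P (subst (λ w → w + d ≡ P) arc[d]≡0 arc[d]+d≡P)

  -- ±p ± q ± r ≡ 0 (mod P), spelled out for 0 < p, q, r ≤ k
  data Balanced (p q r : ℕ) : Set where
    is-sum₃   : r ≡ p + q → Balanced p q r
    is-sum₂   : q ≡ p + r → Balanced p q r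
    is-sum₁   : p ≡ q + r → Balanced p q r
    perimeter : p + q + r ≡ P → Balanced p q r

  balanced-swap₁₂ : ∀ {p q r} → Balanced p q r → Balanced q p r
  balanced-swap₁₂ {p} {q}     (is-sum₃ r≡p+q) = is-sum₃ (trans r≡p+q (+-comm p q))
  balanced-swap₁₂             (is-sum₂ q≡p+r) = is-sum₁ q≡p+r
  balanced-swap₁₂             (is-sum₁ p≡q+r) = is-sum₂ p≡q+r
  balanced-swap₁₂ {p} {q} {r} (perimeter Σ≡P) = perimeter (trans (cong (_+ r) (+-comm q p)) Σ≡P)

  balanced-swap₂₃ : ∀ {p q r} → Balanced p q r → Balanced p r q
  balanced-swap₂₃             (is-sum₃ r≡p+q) = is-sum₂ r≡p+q
  balanced-swap₂₃             (is-sum₂ q≡p+r) = is-sum₃ q≡p+r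
  balanced-swap₂₃     {q = q} {r} (is-sum₁ p≡q+r) = is-sum₁ (trans p≡q+r (+-comm q r))
  balanced-swap₂₃ {p} {q} {r} (perimeter Σ≡P) = perimeter (trans (xy∙z≈xz∙y p r q) Σ≡P)

  arc-balanced : ∀ d e → d + e < P → Balanced (arc d) (arc e) (arc (d + e))
  arc-balanced d e d+e<P
    with arc-view d (≤-trans (m≤m+n d e) (<⇒≤ d+e<P))
       | arc-view e (≤-trans (m≤n+m e d) (<⇒≤ d+e<P))
       | arc-view (d + e) (<⇒≤ d+e<P)
  ... | short _ arc[d]≡d | short _ arc[e]≡e | short _ arc[s]≡s
    rewrite arc[d]≡d | arc[e]≡e = is-sum₃ arc[s]≡s
  ... | short _ arc[d]≡d | short _ arc[e]≡e | long _ arc[s]+s≡P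
    rewrite arc[d]≡d | arc[e]≡e = perimeter (trans (+-comm (d + e) _) arc[s]+s≡P)
  ... | long _ arc[d]+d≡P | short _ arc[e]≡e | long _ arc[s]+s≡P
    rewrite arc[e]≡e = is-sum₁ (+-cancelʳ-≡ d _ _
      (trans arc[d]+d≡P (trans (≡-sym arc[s]+s≡P) (x∙yz≈zx∙y (arc (d + e)) d e))))
  ... | short _ arc[d]≡d | long _ arc[e]+e≡P | long _ arc[s]+s≡P
    rewrite arc[d]≡d = is-sum₂ (+-cancelʳ-≡ e _ _
      (trans arc[e]+e≡P (trans (≡-sym arc[s]+s≡P) (x∙yz≈yx∙z (arc (d + e)) d e))))
  ... | long k<d _ | long k<e _ | _ =
    ⊥-elim (<⇒≱ d+e<P (≤-trans (≤-reflexive P≡1+k+k) (+-mono-≤ k<d (<⇒≤ k<e))))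
  ... | long k<d _ | _ | short s≤k _ = ⊥-elim (<⇒≱ k<d (≤-trans (m≤m+n d e) s≤k))
  ... | _ | long k<e _ | short s≤k _ = ⊥-elim (<⇒≱ k<e (≤-trans (m≤n+m e d) s≤k))

  dist-balanced : ∀ {x y z} → x < P → y < P → z < P → x ≢ y → y ≢ z → x ≢ z →
                  Balanced (dist x y) (dist y z) (dist x z)
  dist-balanced x<P y<P z<P x≢y y≢z x≢z =
    wlog-increasing Q Q-swap₁₂ Q-swap₂₃ increasing x≢y y≢z x≢z x<P y<P z<P
    where
    Q : ℕ → ℕ → ℕ → Set
    Q x y z = x < P → y < P → z < P → Balanced (dist x y) (dist y z) (dist x z)

    open Symmetric₃ Balanced balanced-swap₁₂ balanced-swap₂₃ using (swap₁₃)

    Q-swap₁₂ : ∀ {x y z} → Q x y z → Q y x z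
    Q-swap₁₂ {x} {y} q y<P x<P z<P =
      subst (λ w → Balanced w _ _) (dist-comm x y) (balanced-swap₂₃ (q x<P y<P z<P))

    Q-swap₂₃ : ∀ {x y z} → Q x y z → Q x z y
    Q-swap₂₃ {x} {y} {z} q x<P z<P y<P =
      subst (λ w → Balanced _ w _) (dist-comm y z) (swap₁₃ (q x<P y<P z<P))

    increasing : ∀ {x y z} → x < y → y < z → Q x y z
    increasing {x} x<y y<z _ _ z<P
      with d , refl ← m≤n⇒∃[o]m+o≡n (<⇒≤ x<y)
      with e , refl ← m≤n⇒∃[o]m+o≡n (<⇒≤ y<z)
      rewrite ∣m-m+n∣≡n x d | ∣m-m+n∣≡n (x + d) e | +-assoc x d e | ∣m-m+n∣≡n x (d + e)
      = arc-balanced d e (≤-<-trans (m≤n+m (d + e) x) z<P)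

  data Admissible (A B D : ℕ) : Set where
    sum       : D ≡ A + B → Admissible A B D
    perimeter : A + B + D ≡ P → Admissible A B D

  balanced⇒admissible : ∀ {A B D} → A < B → B < D → Balanced A B D → Admissible A B D
  balanced⇒admissible         _   _   (is-sum₃ D≡A+B) = sum D≡A+B
  balanced⇒admissible {A}     _   B<D (is-sum₂ B≡A+D) =
    ⊥-elim (<⇒≱ B<D (≤-trans (m≤n+m _ A) (≤-reflexive (≡-sym B≡A+D))))
  balanced⇒admissible {A} {B} A<B _   (is-sum₁ A≡B+D) =
    ⊥-elim (<⇒≱ A<B (≤-trans (m≤m+n B _) (≤-reflexive (≡-sym A≡B+D))))
  balanced⇒admissible         _   _   (perimeter Σ≡P) = perimeter Σ≡P

  arc-admissible : ∀ {A B D} → D ≤ k → Admissible A B D → arc (A + B) ≡ D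
  arc-admissible D≤k (sum refl) = arc-low D≤k
  arc-admissible {A} {B} {D} D≤k (perimeter Σ≡P) = begin
    arc (A + B)       ≡⟨ cong arc (≡-sym (trans (cong (_∸ D) (≡-sym Σ≡P)) (m+n∸n≡m (A + B) D))) ⟩
    arc (P ∸ D)       ≡⟨ arc[P∸d]≡arc[d] (≤-trans (m≤n+m D (A + B)) (≤-reflexive Σ≡P)) ⟩
    arc D             ≡⟨ arc-low D≤k ⟩
    D                 ∎
    where open ≡-Reasoning

  admissible⇒A+B<P : ∀ {A B D} → 0 < D → D ≤ k → Admissible A B D → A + B < P
  admissible⇒A+B<P _ D≤k (sum refl) = ≤-<-trans D≤k k<P
  admissible⇒A+B<P {A} {B} 0<D _ (perimeter Σ≡P) = subst (A + B <_) Σ≡P (m<m+n (A + B) 0<D)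

  admissible-cong : ∀ {A A′ B B′ D D′} → A ≡ A′ → B ≡ B′ → D ≡ D′ →
                    Admissible A B D → Admissible A′ B′ D′
  admissible-cong refl refl refl adm = adm

  private
    A+2B≡B+[A+B] : ∀ A B → A + 2 * B ≡ B + (A + B)
    A+2B≡B+[A+B] = solve-∀

    A+2B<P⇒A+B≤P : ∀ A B → A + 2 * B < P → A + B ≤ P
    A+2B<P⇒A+B≤P A B A+2B<P =
      ≤-trans (m≤n+m (A + B) B) (≤-trans (≤-reflexive (≡-sym (A+2B≡B+[A+B] A B))) (<⇒≤ A+2B<P))

  admissible-arc : ∀ A B → A + 2 * B < P → Admissible A B (arc (A + B))
  admissible-arc A B A+2B<P with arc-view (A + B) (A+2B<P⇒A+B≤P A B A+2B<P)
  ... | short _ arc[s]≡s   = sum arc[s]≡s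
  ... | long  _ arc[s]+s≡P = perimeter (trans (+-comm (A + B) _) arc[s]+s≡P)

  <-arc : ∀ A B → 0 < A → A + 2 * B < P → B < arc (A + B)
  <-arc A B 0<A A+2B<P with arc-view (A + B) (A+2B<P⇒A+B≤P A B A+2B<P)
  ... | short _ arc[s]≡s   = subst (B <_) (≡-sym arc[s]≡s) (m<n+m B 0<A)
  ... | long  _ arc[s]+s≡P = +-cancelʳ-< (A + B) B _
          (subst (B + (A + B) <_) (≡-sym arc[s]+s≡P) (subst (_< P) (A+2B≡B+[A+B] A B) A+2B<P))

  admissible⇒A+2B<P : ∀ {A B D} → B < D → D ≤ k → Admissible A B D → A + 2 * B < P
  admissible⇒A+2B<P {A} {B} B<D D≤k (sum refl) =
    subst (_< P) (≡-sym (A+2B≡B+[A+B] A B))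
      (<-≤-trans (+-monoˡ-< (A + B) B<D) (≤-trans (+-mono-≤ D≤k D≤k) (<⇒≤ k+k<P)))
  admissible⇒A+2B<P {A} {B} {D} B<D D≤k (perimeter Σ≡P) =
    subst (_< P) (≡-sym (A+2B≡B+[A+B] A B)) (subst (B + (A + B) <_) Σ≡P
      (subst (_< A + B + D) (+-comm (A + B) B) (+-monoʳ-< (A + B) B<D)))

  instance
    P-nonZero : NonZero P
    P-nonZero = >-nonZero (subst (0 <_) (≡-sym P≡1+k+k) z<s)

  dist-+% : ∀ {x c} → x < P → c ≤ P → dist x ((x + c) % P) ≡ arc c
  dist-+% {x} {c} x<P c≤P with x + c <? P
  ... | yes x+c<P = begin
    dist x ((x + c) % P) ≡⟨ cong (dist x) (m<n⇒m%n≡m x+c<P) ⟩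
    arc ∣ x - x + c ∣     ≡⟨ cong arc (∣m-m+n∣≡n x c) ⟩
    arc c                 ∎
    where open ≡-Reasoning
  ... | no x+c≮P = begin
    dist x ((x + c) % P)    ≡⟨ cong (dist x) [x+c]%P≡y ⟩
    arc ∣ x - y ∣           ≡⟨ cong (λ w → arc ∣ w - y ∣) (≡-sym y+[P∸c]≡x) ⟩
    arc ∣ y + (P ∸ c) - y ∣ ≡⟨ cong arc (trans (∣-∣-comm _ y) (∣m-m+n∣≡n y (P ∸ c))) ⟩
    arc (P ∸ c)             ≡⟨ arc[P∸d]≡arc[d] c≤P ⟩
    arc c                   ∎
    where
    open ≡-Reasoning
    y : ℕ
    y = x + c ∸ P

    y+P≡x+c : y + P ≡ x + c
    y+P≡x+c = m∸n+n≡m (≮⇒≥ x+c≮P)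

    y+[P∸c]≡x : y + (P ∸ c) ≡ x
    y+[P∸c]≡x = +-cancelʳ-≡ c _ _ (begin
      y + (P ∸ c) + c   ≡⟨ +-assoc y (P ∸ c) c ⟩
      y + (P ∸ c + c)   ≡⟨ cong (y +_) (m∸n+n≡m c≤P) ⟩
      y + P             ≡⟨ y+P≡x+c ⟩
      x + c             ∎)

    y<P : y < P
    y<P = +-cancelʳ-< P y P (subst (_< P + P) (≡-sym y+P≡x+c) (+-mono-<-≤ x<P c≤P))

    [x+c]%P≡y : (x + c) % P ≡ y
    [x+c]%P≡y = begin
      (x + c) % P ≡⟨ cong (_% P) (≡-sym y+P≡x+c) ⟩
      (y + P) % P ≡⟨ [m+n]%n≡m%n y P ⟩
      y % P       ≡⟨ m<n⇒m%n≡m y<P ⟩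
      y           ∎

  ∣-∣<P : ∀ {x y} → x < P → y < P → ∣ x - y ∣ < P
  ∣-∣<P {x} {y} x<P y<P = ≤-<-trans (∣m-n∣≤m⊔n x y) (⊔-lub x<P y<P)

  dist-positive : ∀ {x y} → x < P → y < P → x ≢ y → 0 < dist x y
  dist-positive x<P y<P x≢y = arc-positive (n≢0⇒n>0 (x≢y ∘ ∣m-n∣≡0⇒m≡n)) (∣-∣<P x<P y<P)


-- The distance colouring of K_P

module DistanceColouring (m : ℕ) where

  k : ℕ
  k = suc m

  open CircularDistance k public

  -- colour i is given to the chords of length i + 1 (and, as junk, to the loops)
  len : Fin k → ℕ
  len i = suc (toℕ i)

  colour : Fin P → Fin P → Fin k
  colour u v = fromℕ< (s≤s (pred-mono-≤ (arc≤k ∣ toℕ u - toℕ v ∣)))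

  colouring : Colouring P k
  colouring = record
    { col = colour
    ; sym = λ u v → fromℕ<-cong _ _ (cong pred (dist-comm (toℕ u) (toℕ v))) _ _
    }

  len<P : ∀ i → len i < P
  len<P i = ≤-<-trans (toℕ<n i) k<P

  len-colour : ∀ {u v} → u ≢ v → len (colour u v) ≡ dist (toℕ u) (toℕ v)
  len-colour {u} {v} u≢v = trans (cong suc (toℕ-fromℕ< _))
    (suc-pred _ {{>-nonZero (dist-positive (toℕ<n u) (toℕ<n v) (u≢v ∘ toℕ-injective))}})

  colour-≡ : ∀ u v {i} → dist (toℕ u) (toℕ v) ≡ len i → colour u v ≡ i
  colour-≡ _ _ dist≡len = toℕ-injective (trans (toℕ-fromℕ< _) (cong pred dist≡len))

  triangle-balanced : ∀ {a b d} → ColouredTriangle colouring a b d →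
                      Balanced (len a) (len b) (len d)
  triangle-balanced record { x = x ; y = y ; z = z ; x≢y = x≢y ; y≢z = y≢z ; x≢z = x≢z
                           ; col-xy = refl ; col-yz = refl ; col-xz = refl }
    rewrite len-colour x≢y | len-colour y≢z | len-colour x≢z
    = dist-balanced (toℕ<n x) (toℕ<n y) (toℕ<n z)
        (x≢y ∘ toℕ-injective) (y≢z ∘ toℕ-injective) (x≢z ∘ toℕ-injective)

  admissible⇒triangle : ∀ {a b d} → Admissible (len a) (len b) (len d) →
                        ColouredTriangle colouring a b d
  admissible⇒triangle {a} {b} {d} adm = record
    { x = vertex 0 0<P ; y = vertex A A<P ; z = vertex (A + B) A+B<P
    ; x≢y = vertex-≢ 0<P A<P 0≢1+n
    ; y≢z = vertex-≢ A<P A+B<P (<⇒≢ (m<m+n A z<s))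
    ; x≢z = vertex-≢ 0<P A+B<P 0≢1+n
    ; col-xy = colour-≡ (vertex 0 0<P) (vertex A A<P)
        (trans (cong₂ dist (toℕ-fromℕ< 0<P) (toℕ-fromℕ< A<P)) (arc-low (toℕ<n a)))
    ; col-yz = colour-≡ (vertex A A<P) (vertex (A + B) A+B<P)
        (trans (cong₂ dist (toℕ-fromℕ< A<P) (toℕ-fromℕ< A+B<P))
               (trans (cong arc (∣m-m+n∣≡n A B)) (arc-low (toℕ<n b))))
    ; col-xz = colour-≡ (vertex 0 0<P) (vertex (A + B) A+B<P)
        (trans (cong₂ dist (toℕ-fromℕ< 0<P) (toℕ-fromℕ< A+B<P)) (arc-admissible (toℕ<n d) adm))
    }
    where
    A = len a
    B = len b

    A+B<P : A + B < P
    A+B<P = admissible⇒A+B<P z<s (toℕ<n d) adm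
    A<P : A < P
    A<P = ≤-<-trans (m≤m+n A B) A+B<P
    0<P : 0 < P
    0<P = ≤-<-trans z≤n A<P

    vertex : ∀ n → n < P → Fin P
    vertex n n<P = fromℕ< n<P

    vertex-≢ : ∀ {n n′} (n<P : n < P) (n′<P : n′ < P) → n ≢ n′ → vertex n n<P ≢ vertex n′ n′<P
    vertex-≢ n<P n′<P n≢n′ eq =
      n≢n′ (trans (≡-sym (toℕ-fromℕ< n<P)) (trans (cong toℕ eq) (toℕ-fromℕ< n′<P)))

  AdmissibleTriple : Triple k → Set
  AdmissibleTriple t = Admissible (len (Triple.a t)) (len (Triple.b t)) (len (Triple.d t))

  occurs⇔admissible : ∀ t → Occurs colouring t ⇔ AdmissibleTriple t
  occurs⇔admissible t@(triple a b d a<b b<d) = mk⇔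
    (balanced⇒admissible (s<s a<b) (s<s b<d) ∘ triangle-balanced
                                             ∘ Equivalence.to (occurs⇔triangle colouring t))
    (Equivalence.from (occurs⇔triangle colouring t) ∘ admissible⇒triangle)

  triple-≡ : ∀ {a a′ b b′ d d′ : Fin k} {a<b a′<b′ b<d b′<d′} →
             a ≡ a′ → b ≡ b′ → d ≡ d′ → triple a b d a<b b<d ≡ triple a′ b′ d′ a′<b′ b′<d′
  triple-≡ {a<b = a<b} {a′<b′} {b<d} {b′<d′} refl refl refl =
    cong₂ (triple _ _ _) (<-irrelevant a<b a′<b′) (<-irrelevant b<d b′<d′)

  lattice⇔A+2B<P : ∀ {a b} → a + 2 * b < 2 * m ⇔ suc a + 2 * suc b < P
  lattice⇔A+2B<P {a} {b} = mk⇔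
    (λ a+2b<2m → subst₂ _<_ (≡-sym (shift-weight a b)) 3+2m≡P (+-monoʳ-< 3 a+2b<2m))
    (λ A+2B<P → +-cancelˡ-< 3 _ _ (subst₂ _<_ (shift-weight a b) (≡-sym 3+2m≡P) A+2B<P))
    where
    3+2m≡P : 3 + 2 * m ≡ P
    3+2m≡P = rearrange m
      where
      rearrange : ∀ m → 3 + 2 * m ≡ 2 * suc m + 1
      rearrange = solve-∀

  toTriple : (p : ℕ × ℕ) → LatticePoint (2 * m) p → Triple k
  toTriple (a , b) (a<b , a+2b<2m) = triple (fromℕ< a<k) (fromℕ< b<k) (fromℕ< d<k)
    (subst₂ _<_ (≡-sym (toℕ-fromℕ< a<k)) (≡-sym (toℕ-fromℕ< b<k)) a<b)
    (subst₂ _<_ (≡-sym (toℕ-fromℕ< b<k)) (≡-sym (toℕ-fromℕ< d<k))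
      (pred-mono-< (<-arc (suc a) (suc b) z<s (Equivalence.to lattice⇔A+2B<P a+2b<2m))))
    where
    b<k : b < k
    b<k = m<n⇒m<1+n (*-cancelˡ-< 2 b m (≤-<-trans (m≤n+m (2 * b) a) a+2b<2m))
    a<k : a < k
    a<k = <-trans a<b b<k
    d<k : pred (arc (suc a + suc b)) < k
    d<k = s≤s (pred-mono-≤ (arc≤k (suc a + suc b)))

  toTriple-injective : ∀ {p q} (h : LatticePoint (2 * m) p) (h′ : LatticePoint (2 * m) q) →
                       toTriple p h ≡ toTriple q h′ → p ≡ q
  toTriple-injective _ _ eq = cong₂ _,_
    (trans (≡-sym (toℕ-fromℕ< _)) (trans (cong (toℕ ∘ Triple.a) eq) (toℕ-fromℕ< _)))
    (trans (≡-sym (toℕ-fromℕ< _)) (trans (cong (toℕ ∘ Triple.b) eq) (toℕ-fromℕ< _)))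

  admissible-toTriple : ∀ p (h : LatticePoint (2 * m) p) → AdmissibleTriple (toTriple p h)
  admissible-toTriple (a , b) (_ , a+2b<2m) =
    admissible-cong (cong suc (≡-sym (toℕ-fromℕ< _))) (cong suc (≡-sym (toℕ-fromℕ< _)))
      (trans (≡-sym (suc-pred _ {{>-nonZero 0<D}})) (cong suc (≡-sym (toℕ-fromℕ< _))))
      (admissible-arc (suc a) (suc b) A+2B<P)
    where
    A+2B<P : suc a + 2 * suc b < P
    A+2B<P = Equivalence.to lattice⇔A+2B<P a+2b<2m
    0<D : 0 < arc (suc a + suc b)
    0<D = ≤-<-trans z≤n (<-arc (suc a) (suc b) z<s A+2B<P)

  admissible⇒toTriple : ∀ t → AdmissibleTriple t →
    Σ (LatticePoint (2 * m) (toℕ (Triple.a t) , toℕ (Triple.b t))) λ h → toTriple _ h ≡ t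
  admissible⇒toTriple (triple a b d a<b b<d) adm =
    (a<b , Equivalence.from lattice⇔A+2B<P (admissible⇒A+2B<P (s<s b<d) (toℕ<n d) adm)) ,
    triple-≡ (fromℕ<-toℕ a _) (fromℕ<-toℕ b _)
      (toℕ-injective (trans (toℕ-fromℕ< _) (cong pred (arc-admissible (toℕ<n d) adm))))

  private
    toTriple∈ : ∀ {p} → p ∈ latticePoints (2 * m) → Triple k
    toTriple∈ {p} p∈ = toTriple p (∈-latticePoints⁻ (2 * m) p∈)

  admissibleTriples : List (Triple k)
  admissibleTriples = mapWith∈ (latticePoints (2 * m)) toTriple∈

  ∈-admissibleTriples⇔ : ∀ t → t ∈ admissibleTriples ⇔ AdmissibleTriple t
  ∈-admissibleTriples⇔ t = mk⇔ to from
    where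
    to : t ∈ admissibleTriples → AdmissibleTriple t
    to t∈ with Any.mapWith∈⁻ (latticePoints (2 * m)) toTriple∈ t∈
    ... | p , p∈ , refl = admissible-toTriple p (∈-latticePoints⁻ (2 * m) p∈)

    from : AdmissibleTriple t → t ∈ admissibleTriples
    from adm with admissible⇒toTriple t adm
    ... | h , toTriple≡t = Any.mapWith∈⁺ toTriple∈
      ( _ , ∈-latticePoints⁺ (2 * m) h
      , trans (≡-sym toTriple≡t) (cong (toTriple _) (latticePoint-irrelevant h _)))

  admissibleTriples-unique : Unique admissibleTriples
  admissibleTriples-unique = mapWith∈-unique (latticePoints (2 * m)) toTriple∈
    (λ _ _ → toTriple-injective _ _) (latticePoints-unique (2 * m))

  length-admissibleTriples : length admissibleTriples ≡ length (latticePoints (2 * m))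
  length-admissibleTriples = length-mapWith∈ (latticePoints (2 * m)) toTriple∈

  vertexMod : ℕ → Fin P
  vertexMod n = fromℕ< (m%n<n n P)

  toℕ-vertexMod : ∀ n → toℕ (vertexMod n) ≡ n % P
  toℕ-vertexMod n = toℕ-fromℕ< (m%n<n n P)

  vertexMod-toℕ : ∀ u → vertexMod (toℕ u) ≡ u
  vertexMod-toℕ u = toℕ-injective (trans (toℕ-vertexMod (toℕ u)) (m<n⇒m%n≡m (toℕ<n u)))

  module _ (i : Fin k) where

    dist-+len : ∀ n → dist (toℕ (vertexMod n)) (toℕ (vertexMod (n + len i))) ≡ len i
    dist-+len n = begin
      dist (toℕ (vertexMod n)) (toℕ (vertexMod (n + len i)))
        ≡⟨ cong₂ dist (toℕ-vertexMod n) (toℕ-vertexMod (n + len i)) ⟩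
      dist (n % P) ((n + len i) % P)
        ≡⟨ cong (dist (n % P)) (%-cong-+ P (n % P) n (len i) (len i) (m%n%n≡m%n n P) refl) ⟨
      dist (n % P) ((n % P + len i) % P)
        ≡⟨ dist-+% (m%n<n n P) (<⇒≤ (len<P i)) ⟩
      arc (len i)
        ≡⟨ arc-low (toℕ<n i) ⟩
      len i ∎
      where open ≡-Reasoning

    edge : ∀ n → vertexMod n ≢ vertexMod (n + len i) ×
                 colour (vertexMod n) (vertexMod (n + len i)) ≡ i
    edge n = loop-free , colour-≡ (vertexMod n) (vertexMod (n + len i)) (dist-+len n)
      where
      loop-free : vertexMod n ≢ vertexMod (n + len i)
      loop-free u≡v = 0≢1+n (trans (cong arc (≡-sym (∣n-n∣≡0 (toℕ (vertexMod n)))))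
        (subst (λ v → dist (toℕ (vertexMod n)) (toℕ v) ≡ len i) (≡-sym u≡v) (dist-+len n)))

    walk : ∀ s n → Walk colouring i (vertexMod n) (vertexMod (n + s * len i))
    walk zero    n = subst (Walk colouring i (vertexMod n) ∘ vertexMod) (≡-sym (+-identityʳ n)) here
    walk (suc s) n = step (proj₁ (edge n)) (proj₂ (edge n))
      (subst (Walk colouring i (vertexMod (n + len i)) ∘ vertexMod)
             (+-assoc n (len i) (s * len i)) (walk s (n + len i)))

    colour-connected : Prime P → ColourConnected colouring i
    colour-connected P-prime = (vertexMod 0 , vertexMod (0 + len i) , edge 0) , connect
      where
      bézout : Bézout.Identity 1 P (len i)
      bézout = coprime-Bézout (prime⇒coprime P-prime (len<P i))

      connect : ∀ u v → Walk colouring i u v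
      connect u v with s , sc≡r ← bézout⇒multiples bézout (toℕ v + (P ∸ toℕ u)) =
        subst₂ (Walk colouring i) (vertexMod-toℕ u)
          (toℕ-injective (trans (toℕ-vertexMod (toℕ u + s * len i)) end≡v)) (walk s (toℕ u))
        where
        open ≡-Reasoning
        end≡v : (toℕ u + s * len i) % P ≡ toℕ v
        end≡v = begin
          (toℕ u + s * len i) % P
            ≡⟨ %-cong-+ P (toℕ u) (toℕ u) (s * len i) _ refl sc≡r ⟩
          (toℕ u + (toℕ v + (P ∸ toℕ u))) % P
            ≡⟨ cong (_% P) (x∙yz≈y∙xz (toℕ u) (toℕ v) _) ⟩
          (toℕ v + (toℕ u + (P ∸ toℕ u))) % P
            ≡⟨ cong (λ w → (toℕ v + w) % P) (m+[n∸m]≡n (<⇒≤ (toℕ<n u))) ⟩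
          (toℕ v + P) % P
            ≡⟨ [m+n]%n≡m%n (toℕ v) P ⟩
          toℕ v % P
            ≡⟨ m<n⇒m%n≡m (toℕ<n v) ⟩
          toℕ v ∎

[2+n]n/3≡ : ∀ n {L} → 3 * L + 1 ≡ suc n * suc n → (2 + n) * n / 3 ≡ L
[2+n]n/3≡ n {L} 3L+1≡[1+n]² = begin
  (2 + n) * n / 3 ≡⟨ cong (_/ 3) (+-cancelʳ-≡ 1 _ _ (trans (square-1 n) (≡-sym 3L+1≡[1+n]²))) ⟩
  3 * L / 3       ≡⟨ cong (_/ 3) (*-comm 3 L) ⟩
  L * 3 / 3       ≡⟨ m*n/n≡m L 3 ⟩
  L               ∎
  where
  open ≡-Reasoning
  square-1 : ∀ n → (2 + n) * n + 1 ≡ suc n * suc n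
  square-1 = solve-∀

proposition3 : (k : ℕ) → 2 ≤ k → Prime (2 * k + 1) →
    Σ (Colouring (2 * k + 1) k) λ c →
      IsConnectedColouring c × NumOccurringIs c ((k * (k ∸ 2)) / 3)
proposition3 zero          ()
proposition3 (suc zero)    (s≤s ())
proposition3 (suc (suc n)) _ P-prime =
  colouring , (λ i → colour-connected i P-prime) ,
  admissibleTriples , admissibleTriples-unique , length≡ ,
  λ t → ⇔-trans (∈-admissibleTriples⇔ t) (⇔-sym (occurs⇔admissible t))
  where
  open DistanceColouring (suc n)
  length≡ : length admissibleTriples ≡ (2 + n) * n / 3
  length≡ = trans length-admissibleTriples
    (≡-sym ([2+n]n/3≡ n (latticePoints-count (suc n) (prime⇒3∤ (s≤s z≤n) P-prime))))
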